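{- Every connected claw-free cubic graph not isomorphic to $K_4$ has a disconnecting perfect matching.
   Context: All graphs are finite and simple. A graph is claw-free if it has no induced subgraph isomorphic to $K_{1,3}$. A perfect matching $M$ of $G$ is disconnecting (separating) if $G-M$ has more connected components than $G$. -}

module Defs where

open import Data.Nat using (ℕ; _≥_)
open import Data.Fin using (Fin)
open import Data.Bool using (Bool; true; false; if_then_else_; _∧_; not)
open import Data.List using (List; map; allFin)
open import Data.Nat.ListAction using (sum)
open import Data.Product using (Σ; ∃; ∃-syntax; _×_; _,_)
open import Relation.Binary.PropositionalEquality using (_≡_; _≢_; refl; cong; cong₂) renaming (sym to sym≡)
open import Data.Fin using (_≟_)
open import Relation.Nullary using (yes; no)
open import Relation.Nullary.Decidable using (⌊_⌋)
open import Data.Empty using (⊥-elim)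
open import Relation.Nullary using (¬_)
open import Function.Bundles using (_↔_; Inverse)

record Graph (n : ℕ) : Set where
  field
    adj   : Fin n → Fin n → Bool
    sym   : ∀ u v → adj u v ≡ adj v u
    irref : ∀ v → adj v v ≡ false

open Graph public

Adj : ∀ {n} → Graph n → Fin n → Fin n → Set
Adj G u v = adj G u v ≡ true

degree : ∀ {n} → Graph n → Fin n → ℕ
degree {n} G v = sum (map (λ u → if adj G v u then 1 else 0) (allFin n))

Cubic : ∀ {n} → Graph n → Set
Cubic G = ∀ v → degree G v ≡ 3

data Reachable {n : ℕ} (G : Graph n) : Fin n → Fin n → Set where
  here  : ∀ {u} → Reachable G u u
  step  : ∀ {u w v} → Adj G u w → Reachable G w v → Reachable G u v

Connected : ∀ {n} → Graph n → Set
Connected {n} G = n ≥ 1 × (∀ u v → Reachable G u v)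

ClawFree : ∀ {n} → Graph n → Set
ClawFree {n} G =
  ¬ (Σ (Fin n) λ c → Σ (Fin n) λ a → Σ (Fin n) λ b → Σ (Fin n) λ d →
       Adj G c a × Adj G c b × Adj G c d ×
       a ≢ b × a ≢ d × b ≢ d ×
       ¬ Adj G a b × ¬ Adj G a d × ¬ Adj G b d)

K : (m : ℕ) → Graph m
K m = record { adj = λ u v → not ⌊ u ≟ v ⌋ ; sym = symK ; irref = irrK }
  where
    symK : ∀ u v → not ⌊ u ≟ v ⌋ ≡ not ⌊ v ≟ u ⌋
    symK u v with u ≟ v | v ≟ u
    ... | yes _ | yes _ = refl
    ... | no _  | no _  = refl
    ... | yes p | no q  = ⊥-elim (q (sym≡ p))
    ... | no p  | yes q = ⊥-elim (p (sym≡ q))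
    irrK : ∀ v → not ⌊ v ≟ v ⌋ ≡ false
    irrK v with v ≟ v
    ... | yes _ = refl
    ... | no p  = ⊥-elim (p refl)

record _≅_ {n m : ℕ} (G : Graph n) (H : Graph m) : Set where
  field
    bij      : Fin n ↔ Fin m
    preserve : ∀ u v → adj G u v ≡ adj H (Inverse.to bij u) (Inverse.to bij v)

record PerfectMatching {n : ℕ} (G : Graph n) : Set where
  field
    inM      : Fin n → Fin n → Bool
    symM     : ∀ u v → inM u v ≡ inM v u
    sub      : ∀ u v → inM u v ≡ true → Adj G u v
    covered  : ∀ v → Σ (Fin n) λ u → inM v u ≡ true × (∀ w → inM v w ≡ true → w ≡ u)

open PerfectMatching public

_−_ : ∀ {n} (G : Graph n) → PerfectMatching G → Graph n
G − M = record
  { adj   = λ u v → adj G u v ∧ not (inM M u v)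
  ; sym   = λ u v → cong₂ (λ x y → x ∧ not y) (Graph.sym G u v) (symM M u v)
  ; irref = λ v → cong (λ x → x ∧ not (inM M v v)) (irref G v)
  }

-- M is disconnecting: G − M has more connected components than G.
-- Since every component of G − M lies inside a component of G, this
-- holds exactly when some two vertices joined by a walk in G are not
-- joined by a walk in G − M.
Disconnecting : ∀ {n} (G : Graph n) → PerfectMatching G → Set
Disconnecting {n} G M =
  Σ (Fin n) λ u → Σ (Fin n) λ v → Reachable G u v × ¬ Reachable (G − M) u v

-- In a connected claw-free cubic graph other than K₄ the three neighbours of a vertex span one or
-- two edges: none would give a claw, and three would close up a K₄ component. So every vertex lies
-- in exactly one triangle, or in exactly two, forming a diamond whose diagonal it is on. Each vertex
-- therefore has exactly one incident edge that does not lie in exactly one triangle, and these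
-- edges form a perfect matching M. Take a vertex u whose only triangle is upq (there is one beside
-- every diamond) and let r be its third neighbour, so ur ∈ M. The triangle or diamond containing pq
-- is closed under the edges of G − M and contains u but not r, so M separates u from r.

module Submission where

open import Defs
open import Data.Bool using (Bool; true; false; not; _∧_; if_then_else_)
open import Data.Bool.Properties using (∧-comm; ¬-not; not-¬)
open import Data.Empty using (⊥-elim)
open import Data.Fin as Fin using (Fin; suc; _≟_)
open import Data.Fin.Patterns using (0F; 1F; 2F; 3F)
open import Data.List using ([]; _∷_; map; tabulate)
open import Data.List.Membership.Propositional using (_∈_)
open import Data.List.Properties using (map-tabulate; tabulate-cong)
open import Data.List.Relation.Unary.All using (All; []; _∷_)
open import Data.List.Relation.Unary.AllPairs using ([]; _∷_)
open import Data.List.Relation.Unary.Any using (here; there)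
open import Data.List.Relation.Unary.Unique.Propositional using (Unique)
open import Data.Nat using (ℕ; zero; suc; _+_; _≡ᵇ_)
open import Data.Nat.Properties using (suc-injective; +-commutativeSemigroup)
open import Algebra.Properties.CommutativeSemigroup +-commutativeSemigroup using (x∙yz≈y∙xz)
open import Data.Nat.ListAction using (sum)
open import Data.Product using (Σ; ∃; ∃₂; _×_; _,_; proj₁; proj₂; swap; uncurry)
open import Data.Sum using (_⊎_; inj₁; inj₂; [_,_]′; map₂)
open import Function using (_∘_; id; case_of_)
open import Function.Bundles using (mk↔ₛ′)
open import Relation.Binary.PropositionalEquality
  using (_≡_; _≢_; refl; cong; cong₂; trans; subst; ≢-sym) renaming (sym to ≡-sym)
open import Relation.Nullary using (¬_; yes; no; does)

⟦_⟧ : Bool → ℕ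
⟦ b ⟧ = if b then 1 else 0

count : ∀ {n} → (Fin n → Bool) → ℕ
count f = sum (tabulate (⟦_⟧ ∘ f))

-- With does rather than ⌊_⌋, (f ∖ suc p) ∘ suc reduces to (f ∘ suc) ∖ p, which count-∖ relies on.
_∖_ : ∀ {n} → (Fin n → Bool) → Fin n → Fin n → Bool
(f ∖ p) w = not (does (w ≟ p)) ∧ f w

module _ {n : ℕ} where

  ∖-≢ : ∀ (f : Fin n → Bool) {p w} → w ≢ p → (f ∖ p) w ≡ f w
  ∖-≢ f {p} {w} w≢p with w ≟ p
  ... | yes w≡p = ⊥-elim (w≢p w≡p)
  ... | no _    = refl

  ∖-true⁻ : ∀ (f : Fin n → Bool) {p w} → (f ∖ p) w ≡ true → f w ≡ true × w ≢ p
  ∖-true⁻ f {p} {w} e with w ≟ p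
  ... | no w≢p = e , w≢p

∧-trueˡ : ∀ {x y} → x ∧ y ≡ true → x ≡ true
∧-trueˡ {true} _ = refl

count-cong : ∀ {n} {f g : Fin n → Bool} → (∀ w → f w ≡ g w) → count f ≡ count g
count-cong f≗g = cong sum (tabulate-cong (cong ⟦_⟧ ∘ f≗g))

count-false : ∀ {n} (f : Fin n → Bool) → (∀ w → f w ≡ false) → count f ≡ 0
count-false {zero}  f f≡false = refl
count-false {suc n} f f≡false rewrite f≡false 0F = count-false (f ∘ Fin.suc) (f≡false ∘ Fin.suc)

count-∖ : ∀ {n} (f : Fin n → Bool) p → count f ≡ ⟦ f p ⟧ + count (f ∖ p)
count-∖ {suc n} f 0F      = refl
count-∖ {suc n} f (suc p) =
  trans (cong (⟦ f 0F ⟧ +_) (count-∖ (f ∘ Fin.suc) p))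
        (x∙yz≈y∙xz ⟦ f 0F ⟧ ⟦ f (suc p) ⟧ (count ((f ∘ Fin.suc) ∖ p)))

count-true : ∀ {n} {f : Fin n → Bool} {p} → f p ≡ true → count f ≡ suc (count (f ∖ p))
count-true {f = f} {p} fp = subst (λ b → count f ≡ ⟦ b ⟧ + count (f ∖ p)) fp (count-∖ f p)

count≡suc⇒∃ : ∀ {n} {f : Fin n → Bool} {k} → count f ≡ suc k → ∃ λ p → f p ≡ true
count≡suc⇒∃ {suc n} {f} h with f 0F in f0
... | true  = 0F , f0
... | false = let p , fp = count≡suc⇒∃ {f = f ∘ Fin.suc} h in suc p , fp

count-pick : ∀ {n} {f : Fin n → Bool} {k} → count f ≡ suc k →
             ∃ λ p → f p ≡ true × count (f ∖ p) ≡ k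
count-pick {f = f} h =
  let p , fp = count≡suc⇒∃ h in p , fp , suc-injective (trans (≡-sym (count-true {f = f} fp)) h)

count-within : ∀ {n} {f : Fin n → Bool} {ps} → Unique ps → (∀ w → f w ≡ true → w ∈ ps) →
               count f ≡ sum (map (⟦_⟧ ∘ f) ps)
count-within {f = f} {[]} [] within = count-false f (λ w → ¬-not (λ fw → case (within w fw) of λ ()))
count-within {f = f} {p ∷ ps} (p∉ps ∷ unique) within =
  trans (count-∖ f p) (cong (⟦ f p ⟧ +_) (trans (count-within unique within-ps) (sum-map-∖ p∉ps)))
  where
    within-ps : ∀ w → (f ∖ p) w ≡ true → w ∈ ps
    within-ps w e with ∖-true⁻ f e
    ... | fw , w≢p with within w fw
    ...   | here w≡p  = ⊥-elim (w≢p w≡p)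
    ...   | there w∈ps = w∈ps
    sum-map-∖ : ∀ {qs} → All (p ≢_) qs → sum (map (⟦_⟧ ∘ (f ∖ p)) qs) ≡ sum (map (⟦_⟧ ∘ f) qs)
    sum-map-∖ []             = refl
    sum-map-∖ (p≢q ∷ p∉qs) = cong₂ _+_ (cong ⟦_⟧ (∖-≢ f (≢-sym p≢q))) (sum-map-∖ p∉qs)

one-of : ∀ {s t} → sum (map ⟦_⟧ (s ∷ t ∷ false ∷ [])) ≡ 1 → s ≡ true ⊎ t ≡ true
one-of {true}         _ = inj₁ refl
one-of {false} {true} _ = inj₂ refl

record Support₃ {n} (f : Fin n → Bool) (a b c : Fin n) : Set where
  field
    holds₁     : f a ≡ true
    holds₂     : f b ≡ true
    holds₃     : f c ≡ true
    distinct₁₂ : a ≢ b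
    distinct₁₃ : a ≢ c
    distinct₂₃ : b ≢ c
    only       : ∀ w → f w ≡ true → w ≡ a ⊎ w ≡ b ⊎ w ≡ c

open Support₃ public

module _ {n : ℕ} {f : Fin n → Bool} where

  swap₁₂ : ∀ {a b c} → Support₃ f a b c → Support₃ f b a c
  swap₁₂ S = record
    { holds₁ = holds₂ S ; holds₂ = holds₁ S ; holds₃ = holds₃ S
    ; distinct₁₂ = ≢-sym (distinct₁₂ S) ; distinct₁₃ = distinct₂₃ S ; distinct₂₃ = distinct₁₃ S
    ; only = λ w → [ inj₂ ∘ inj₁ , map₂ inj₂ ]′ ∘ only S w
    }

  rotate : ∀ {a b c} → Support₃ f a b c → Support₃ f b c a
  rotate S = record
    { holds₁ = holds₂ S ; holds₂ = holds₃ S ; holds₃ = holds₁ S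
    ; distinct₁₂ = distinct₂₃ S ; distinct₁₃ = ≢-sym (distinct₁₂ S) ; distinct₂₃ = ≢-sym (distinct₁₃ S)
    ; only = λ w → [ inj₂ ∘ inj₂ , map₂ inj₁ ]′ ∘ only S w
    }

  swap₂₃ : ∀ {a b c} → Support₃ f a b c → Support₃ f a c b
  swap₂₃ = rotate ∘ swap₁₂

  count≡3⇒support₃ : count f ≡ 3 → ∃₂ λ a b → ∃ (Support₃ f a b)
  count≡3⇒support₃ count≡3 with count-pick count≡3
  ... | a , fa , count₂ with count-pick count₂
  ... | b , fb∖a , count₁ with ∖-true⁻ f fb∖a | count-pick count₁
  ... | fb , b≢a | c , fc∖a∖b , count₀ with ∖-true⁻ (f ∖ a) fc∖a∖b
  ... | fc∖a , c≢b with ∖-true⁻ f fc∖a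
  ... | fc , c≢a = a , b , c , record
    { holds₁ = fa ; holds₂ = fb ; holds₃ = fc
    ; distinct₁₂ = ≢-sym b≢a ; distinct₁₃ = ≢-sym c≢a ; distinct₂₃ = ≢-sym c≢b
    ; only = only′
    }
    where
      only′ : ∀ w → f w ≡ true → w ≡ a ⊎ w ≡ b ⊎ w ≡ c
      only′ w fw with w ≟ a | w ≟ b | w ≟ c
      ... | yes w≡a | _       | _       = inj₁ w≡a
      ... | no _    | yes w≡b | _       = inj₂ (inj₁ w≡b)
      ... | no _    | no _    | yes w≡c = inj₂ (inj₂ w≡c)
      ... | no w≢a  | no w≢b  | no w≢c  =
        case trans (≡-sym (count-true {f = ((f ∖ a) ∖ b) ∖ c} {w} fw∖a∖b∖c)) count₀ of λ ()
        where
          fw∖a∖b∖c : (((f ∖ a) ∖ b) ∖ c) w ≡ true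
          fw∖a∖b∖c = trans (∖-≢ ((f ∖ a) ∖ b) w≢c) (trans (∖-≢ (f ∖ a) w≢b) (trans (∖-≢ f w≢a) fw))

  relist₁ : ∀ {x y z a} → Support₃ f x y z → f a ≡ true → ∃₂ λ b c → Support₃ f a b c
  relist₁ S fa with only S _ fa
  ... | inj₁ refl        = _ , _ , S
  ... | inj₂ (inj₁ refl) = _ , _ , swap₁₂ S
  ... | inj₂ (inj₂ refl) = _ , _ , rotate (rotate S)

  relist₂ : ∀ {x y z a b} → Support₃ f x y z → f a ≡ true → f b ≡ true → a ≢ b →
            ∃ λ c → Support₃ f a b c
  relist₂ S fa fb a≢b with relist₁ S fa
  ... | b′ , c′ , S′ with only S′ _ fb
  ...   | inj₁ refl        = ⊥-elim (a≢b refl)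
  ...   | inj₂ (inj₁ refl) = c′ , S′
  ...   | inj₂ (inj₂ refl) = b′ , swap₂₃ S′

  relist₃ : ∀ {x y z a b c} → Support₃ f x y z → f a ≡ true → f b ≡ true → f c ≡ true →
            a ≢ b → a ≢ c → b ≢ c → Support₃ f a b c
  relist₃ S fa fb fc a≢b a≢c b≢c with relist₂ S fa fb a≢b
  ... | d , S′ with only S′ _ fc
  ...   | inj₁ refl        = ⊥-elim (a≢c refl)
  ...   | inj₂ (inj₁ refl) = ⊥-elim (b≢c refl)
  ...   | inj₂ (inj₂ refl) = S′

  count-∧ : ∀ {a b c} → Support₃ f a b c → (g : Fin n → Bool) →
            count (λ w → f w ∧ g w) ≡ sum (map (⟦_⟧ ∘ g) (a ∷ b ∷ c ∷ []))
  count-∧ {a} {b} {c} S g =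
    trans (count-within unique within) (restrict (holds₁ S) (holds₂ S) (holds₃ S))
    where
      unique : Unique (a ∷ b ∷ c ∷ [])
      unique = (distinct₁₂ S ∷ distinct₁₃ S ∷ []) ∷ (distinct₂₃ S ∷ []) ∷ [] ∷ []
      within : ∀ w → f w ∧ g w ≡ true → w ∈ a ∷ b ∷ c ∷ []
      within w e = [ here , [ there ∘ here , there ∘ there ∘ here ]′ ]′ (only S w (∧-trueˡ e))
      restrict : f a ≡ true → f b ≡ true → f c ≡ true →
                 sum (map (λ w → ⟦ f w ∧ g w ⟧) (a ∷ b ∷ c ∷ [])) ≡
                 sum (map (⟦_⟧ ∘ g) (a ∷ b ∷ c ∷ []))
      restrict fa fb fc rewrite fa | fb | fc = refl

degree≡count : ∀ {n} (G : Graph n) v → degree G v ≡ count (adj G v)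
degree≡count G v = cong sum (map-tabulate id (⟦_⟧ ∘ adj G v))

Reachable-preserves : ∀ {n} {G : Graph n} (P : Fin n → Set) → (∀ {x y} → Adj G x y → P x → P y) →
                      ∀ {x y} → Reachable G x y → P x → P y
Reachable-preserves P closed here           = id
Reachable-preserves P closed (step x~w w⇝y) = Reachable-preserves P closed w⇝y ∘ closed x~w

≅K-by-surjection : ∀ {m n} (G : Graph n) (φ : Fin m → Fin n) → (∀ x → ∃ λ i → φ i ≡ x) →
                   (∀ i j → adj G (φ i) (φ j) ≡ adj (K m) i j) → G ≅ K m
≅K-by-surjection {m} {n} G φ onto φ-adj = record
  { bij      = mk↔ₛ′ index φ index-φ φ-index
  ; preserve = preserve
  }
  where
    index : Fin n → Fin m
    index x = proj₁ (onto x)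
    φ-index : ∀ x → φ (index x) ≡ x
    φ-index x = proj₂ (onto x)
    K-nonadjacent : ∀ {i j} → adj (K m) i j ≡ false → i ≡ j
    K-nonadjacent {i} {j} e with i ≟ j
    ... | yes i≡j = i≡j
    φ-injective : ∀ {i j} → φ i ≡ φ j → i ≡ j
    φ-injective {i} {j} φi≡φj = K-nonadjacent (trans (≡-sym (φ-adj i j)) φi≁φj)
      where
        φi≁φj : adj G (φ i) (φ j) ≡ false
        φi≁φj = subst (λ y → adj G (φ i) y ≡ false) φi≡φj (irref G (φ i))
    index-φ : ∀ i → index (φ i) ≡ i
    index-φ i = φ-injective (φ-index (φ i))
    preserve : ∀ x y → adj G x y ≡ adj (K m) (index x) (index y)
    preserve x y =
      trans (cong₂ (adj G) (≡-sym (φ-index x)) (≡-sym (φ-index y))) (φ-adj (index x) (index y))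

module CubicGraph {n : ℕ} (G : Graph n) (cubic : Cubic G) where

  infix 4 _~_ _≁_
  _~_ _≁_ : Fin n → Fin n → Set
  x ~ y = Adj G x y
  x ≁ y = adj G x y ≡ false

  ~-sym : ∀ {x y} → x ~ y → y ~ x
  ~-sym {x} {y} x~y = trans (sym G y x) x~y

  ≁-sym : ∀ {x y} → x ≁ y → y ≁ x
  ≁-sym {x} {y} x≁y = trans (sym G y x) x≁y

  ~⇒≢ : ∀ {x y} → x ~ y → x ≢ y
  ~⇒≢ {x} x~x refl = case trans (≡-sym x~x) (irref G x) of λ ()

  ≁⇒¬~ : ∀ {x y} → x ≁ y → ¬ x ~ y
  ≁⇒¬~ = not-¬

  Nbhd : Fin n → Fin n → Fin n → Fin n → Set
  Nbhd v = Support₃ (adj G v)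

  opaque
    neighbourhood : ∀ v → ∃₂ λ a b → ∃ (Nbhd v a b)
    neighbourhood v = count≡3⇒support₃ (trans (≡-sym (degree≡count G v)) (cubic v))

  third-neighbour : ∀ {v a b} → v ~ a → v ~ b → a ≢ b → ∃ (Nbhd v a b)
  third-neighbour {v} = relist₂ (proj₂ (proj₂ (proj₂ (neighbourhood v))))

  nbhd-of : ∀ {v a b c} → v ~ a → v ~ b → v ~ c → a ≢ b → a ≢ c → b ≢ c → Nbhd v a b c
  nbhd-of {v} = relist₃ (proj₂ (proj₂ (proj₂ (neighbourhood v))))

  common : Fin n → Fin n → ℕ
  common u x = count (λ w → adj G u w ∧ adj G x w)

  common-sym : ∀ u x → common u x ≡ common x u
  common-sym u x = count-cong (λ w → ∧-comm (adj G u w) (adj G x w))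

  common-nbhd : ∀ {v a b c x s t r} → Nbhd v a b c → adj G x a ≡ s → adj G x b ≡ t → adj G x c ≡ r →
                common v x ≡ sum (map ⟦_⟧ (s ∷ t ∷ r ∷ []))
  common-nbhd {x = x} N refl refl refl = count-∧ N (adj G x)

  ≅K₄ : ∀ {v a b c} → (∀ x y → Reachable G x y) → Nbhd v a b c → a ~ b → a ~ c → b ~ c → G ≅ K 4
  ≅K₄ {v} {a} {b} {c} reach N a~b a~c b~c = ≅K-by-surjection G corner onto corner-adj
    where
      v~a = holds₁ N
      v~b = holds₂ N
      v~c = holds₃ N

      corner : Fin 4 → Fin n
      corner 0F = v
      corner 1F = a
      corner 2F = b
      corner 3F = c

      corner-adj : ∀ i j → adj G (corner i) (corner j) ≡ adj (K 4) i j
      corner-adj 0F 0F = irref G v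
      corner-adj 0F 1F = v~a
      corner-adj 0F 2F = v~b
      corner-adj 0F 3F = v~c
      corner-adj 1F 0F = ~-sym v~a
      corner-adj 1F 1F = irref G a
      corner-adj 1F 2F = a~b
      corner-adj 1F 3F = a~c
      corner-adj 2F 0F = ~-sym v~b
      corner-adj 2F 1F = ~-sym a~b
      corner-adj 2F 2F = irref G b
      corner-adj 2F 3F = b~c
      corner-adj 3F 0F = ~-sym v~c
      corner-adj 3F 1F = ~-sym a~c
      corner-adj 3F 2F = ~-sym b~c
      corner-adj 3F 3F = irref G c

      corner-nbhd : ∀ i → ∃₂ λ j k → ∃ λ l → Nbhd (corner i) (corner j) (corner k) (corner l)
      corner-nbhd 0F = 1F , 2F , 3F , N
      corner-nbhd 1F = 0F , 2F , 3F ,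
        nbhd-of (~-sym v~a) a~b a~c (~⇒≢ v~b) (~⇒≢ v~c) (distinct₂₃ N)
      corner-nbhd 2F = 0F , 1F , 3F ,
        nbhd-of (~-sym v~b) (~-sym a~b) b~c (~⇒≢ v~a) (~⇒≢ v~c) (distinct₁₃ N)
      corner-nbhd 3F = 0F , 1F , 2F ,
        nbhd-of (~-sym v~c) (~-sym a~c) (~-sym b~c) (~⇒≢ v~a) (~⇒≢ v~b) (distinct₁₂ N)

      Corner : Fin n → Set
      Corner x = ∃ λ i → corner i ≡ x

      corner-closed : ∀ {x y} → x ~ y → Corner x → Corner y
      corner-closed x~y (i , refl) with corner-nbhd i
      ... | j , k , l , Nᵢ with only Nᵢ _ x~y
      ...   | inj₁ refl        = j , refl
      ...   | inj₂ (inj₁ refl) = k , refl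
      ...   | inj₂ (inj₂ refl) = l , refl

      onto : ∀ x → Corner x
      onto x = Reachable-preserves Corner corner-closed (reach v x) (0F , refl)

  record OneTriangle (v a b c : Fin n) : Set where
    constructor one-triangle
    field
      nbhd : Nbhd v a b c
      a~b  : a ~ b
      a≁c  : a ≁ c
      b≁c  : b ≁ c

  record TwoTriangles (v a b c : Fin n) : Set where
    constructor two-triangles
    field
      nbhd : Nbhd v a b c
      a~b  : a ~ b
      a~c  : a ~ c
      b≁c  : b ≁ c

  data Shape (v : Fin n) : Set where
    one  : ∀ {a b c} → OneTriangle v a b c → Shape v
    two  : ∀ {a b c} → TwoTriangles v a b c → Shape v

  shape : (∀ x y → Reachable G x y) → ClawFree G → ¬ G ≅ K 4 → ∀ v → Shape v
  shape reach claw-free ≇K₄ v with neighbourhood v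
  ... | a , b , c , N with adj G a b in ab | adj G a c in ac | adj G b c in bc
  ... | true  | true  | true  = ⊥-elim (≇K₄ (≅K₄ reach N ab ac bc))
  ... | true  | true  | false = two (two-triangles N ab ac bc)
  ... | true  | false | true  = two (two-triangles (swap₁₂ N) (~-sym ab) bc ac)
  ... | false | true  | true  = two (two-triangles (rotate (rotate N)) (~-sym ac) (~-sym bc) ab)
  ... | true  | false | false = one (one-triangle N ab ac bc)
  ... | false | true  | false = one (one-triangle (swap₂₃ N) ac ab (≁-sym bc))
  ... | false | false | true  = one (one-triangle (rotate N) bc (≁-sym ab) (≁-sym ac))
  ... | false | false | false = ⊥-elim (claw-free (v , a , b , c , holds₁ N , holds₂ N , holds₃ N ,
                                 distinct₁₂ N , distinct₁₃ N , distinct₂₃ N ,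
                                 not-¬ ab , not-¬ ac , not-¬ bc))

  one-triangle-beside : ∀ {v a b c} → TwoTriangles v a b c → ∃ (OneTriangle b v a)
  one-triangle-beside {v} {a} {b} {c} (two-triangles N a~b a~c b≁c)
    with third-neighbour (~-sym (holds₂ N)) (~-sym a~b) (~⇒≢ (holds₁ N))
  ... | d , Nb =
    d , one-triangle Nb (holds₁ N) (¬-not (far N (distinct₂₃ Nb))) (¬-not (far Na (distinct₁₃ Nb)))
    where
      Na : Nbhd a v b c
      Na = nbhd-of (~-sym (holds₁ N)) a~b a~c (~⇒≢ (holds₂ N)) (~⇒≢ (holds₃ N)) (distinct₂₃ N)
      far : ∀ {x y} → Nbhd x y b c → y ≢ d → ¬ x ~ d
      far Nx y≢d x~d with only Nx _ x~d
      ... | inj₁ refl        = y≢d refl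
      ... | inj₂ (inj₁ refl) = ~⇒≢ (holds₃ Nb) refl
      ... | inj₂ (inj₂ refl) = ≁⇒¬~ b≁c (holds₃ Nb)

  matched : Fin n → Fin n → Bool
  matched u v = adj G u v ∧ not (common u v ≡ᵇ 1)

  matched⁺ : ∀ {u v} → u ~ v → common u v ≢ 1 → matched u v ≡ true
  matched⁺ {u} {v} u~v c≢1 rewrite u~v with common u v
  ... | 0           = refl
  ... | 1           = ⊥-elim (c≢1 refl)
  ... | suc (suc _) = refl

  matched⁻ : ∀ {u v} → matched u v ≡ true → u ~ v × common u v ≢ 1
  matched⁻ {u} {v} e with adj G u v | common u v
  ... | true | 0           = refl , λ ()
  ... | true | suc (suc _) = refl , λ ()

  unmatched⁻ : ∀ {u v} → adj G u v ∧ not (matched u v) ≡ true → u ~ v × common u v ≡ 1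
  unmatched⁻ {u} {v} e with adj G u v | common u v
  ... | true | 1 = refl , refl

  unique-partner : ∀ {v a b c} → Nbhd v a b c → common v a ≡ 1 → common v b ≡ 1 → common v c ≢ 1 →
                   Σ (Fin n) λ u → matched v u ≡ true × (∀ w → matched v w ≡ true → w ≡ u)
  unique-partner {c = c} N ca≡1 cb≡1 cc≢1 = c , matched⁺ (holds₃ N) cc≢1 , unique
    where
      unique : ∀ w → matched _ w ≡ true → w ≡ c
      unique w e with matched⁻ e
      ... | v~w , cw≢1 with only N w v~w
      ...   | inj₁ refl        = ⊥-elim (cw≢1 ca≡1)
      ...   | inj₂ (inj₁ refl) = ⊥-elim (cw≢1 cb≡1)
      ...   | inj₂ (inj₂ refl) = refl

  matching : (∀ v → Shape v) → PerfectMatching G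
  matching shape = record
    { inM     = matched
    ; symM    = λ u v → cong₂ (λ e k → e ∧ not (k ≡ᵇ 1)) (sym G u v) (common-sym u v)
    ; sub     = λ u v → proj₁ ∘ matched⁻
    ; covered = partner
    }
    where
      partner : ∀ v → Σ (Fin n) λ u → matched v u ≡ true × (∀ w → matched v w ≡ true → w ≡ u)
      partner v with shape v
      ... | one {a} {b} {c} (one-triangle N a~b a≁c b≁c) =
        unique-partner N (common-nbhd N (irref G a) a~b a≁c) (common-nbhd N (~-sym a~b) (irref G b) b≁c)
          (λ cc≡1 → case trans (≡-sym (common-nbhd N (≁-sym a≁c) (≁-sym b≁c) (irref G c))) cc≡1 of λ ())
      ... | two {a} {b} {c} (two-triangles N a~b a~c b≁c) =
        unique-partner (rotate N) (common-nbhd N (~-sym a~b) (irref G b) b≁c)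
          (common-nbhd N (~-sym a~c) (≁-sym b≁c) (irref G c))
          (λ ca≡1 → case trans (≡-sym (common-nbhd N (irref G a) a~b a~c)) ca≡1 of λ ())

  -- The triangle or diamond containing the edge pq.
  Block : Fin n → Fin n → Fin n → Set
  Block p q x = x ≡ p ⊎ x ≡ q ⊎ (p ~ x × q ~ x)

  Block-swap : ∀ {p q x} → Block p q x → Block q p x
  Block-swap = [ inj₂ ∘ inj₁ , [ inj₁ , inj₂ ∘ inj₂ ∘ swap ]′ ]′

  OneTriangle-swap : ∀ {u p q r} → OneTriangle u p q r → OneTriangle u q p r
  OneTriangle-swap (one-triangle N p~q p≁r q≁r) = one-triangle (swap₁₂ N) (~-sym p~q) q≁r p≁r

  third-corner : ∀ {u p q r x} → OneTriangle u p q r → u ~ x → p ~ x → x ≡ q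
  third-corner (one-triangle N _ p≁r _) u~x p~x with only N _ u~x
  ... | inj₁ refl        = ⊥-elim (~⇒≢ p~x refl)
  ... | inj₂ (inj₁ refl) = refl
  ... | inj₂ (inj₂ refl) = ⊥-elim (≁⇒¬~ p≁r p~x)

  block-step-end : ∀ {u p q r y} → OneTriangle u p q r → p ~ y → common p y ≡ 1 → Block p q y
  block-step-end T@(one-triangle N p~q _ _) p~y c≡1
    with third-neighbour (~-sym (holds₁ N)) p~q (~⇒≢ (holds₂ N))
  ... | d , Np with only Np _ p~y
  ...   | inj₁ refl        = inj₂ (inj₂ (~-sym (holds₁ N) , ~-sym (holds₂ N)))
  ...   | inj₂ (inj₁ refl) = inj₂ (inj₁ refl)
  ...   | inj₂ (inj₂ refl) with one-of (trans (≡-sym (common-nbhd Np refl refl (irref G _))) c≡1)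
  ...     | inj₁ d~u = ⊥-elim (distinct₂₃ Np (≡-sym (third-corner T (~-sym d~u) p~y)))
  ...     | inj₂ d~q = inj₂ (inj₂ (p~y , ~-sym d~q))

  apex-third-¬~ : ∀ {u p q r w d} → OneTriangle u p q r → p ~ w → q ~ w → Nbhd w p q d → ¬ d ~ p
  apex-third-¬~ {u} {w = w} T@(one-triangle N p~q _ _) p~w q~w Nw d~p with w ≟ u
  ... | yes refl = distinct₂₃ Nw (≡-sym (third-corner T (holds₃ Nw) (~-sym d~p)))
  ... | no w≢u
    with only (nbhd-of (~-sym (holds₁ N)) p~q p~w (~⇒≢ (holds₂ N)) (≢-sym w≢u) (~⇒≢ q~w)) _ (~-sym d~p)
  ...   | inj₁ refl        = ~⇒≢ q~w (≡-sym (third-corner T (~-sym (holds₃ Nw)) p~w))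
  ...   | inj₂ (inj₁ refl) = distinct₂₃ Nw refl
  ...   | inj₂ (inj₂ refl) = ~⇒≢ (holds₃ Nw) refl

  block-step-apex : ∀ {u p q r w y} → OneTriangle u p q r → p ~ w → q ~ w → w ~ y → common w y ≡ 1 →
                    Block p q y
  block-step-apex T p~w q~w w~y c≡1
    with third-neighbour (~-sym p~w) (~-sym q~w) (~⇒≢ (OneTriangle.a~b T))
  ... | d , Nw with only Nw _ w~y
  ...   | inj₁ refl        = inj₁ refl
  ...   | inj₂ (inj₁ refl) = inj₂ (inj₁ refl)
  ...   | inj₂ (inj₂ refl) with one-of (trans (≡-sym (common-nbhd Nw refl refl (irref G _))) c≡1)
  ...     | inj₁ d~p = ⊥-elim (apex-third-¬~ T p~w q~w Nw d~p)
  ...     | inj₂ d~q = ⊥-elim (apex-third-¬~ (OneTriangle-swap T) q~w p~w (swap₁₂ Nw) d~q)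

  block-step : ∀ {u p q r x y} → OneTriangle u p q r → x ~ y → common x y ≡ 1 →
               Block p q x → Block p q y
  block-step T x~y c≡1 (inj₁ refl)               = block-step-end T x~y c≡1
  block-step T x~y c≡1 (inj₂ (inj₁ refl))        = Block-swap (block-step-end (OneTriangle-swap T) x~y c≡1)
  block-step T x~y c≡1 (inj₂ (inj₂ (p~x , q~x))) = block-step-apex T p~x q~x x~y c≡1

  triangle-separated : ∀ {u p q r} (shape : ∀ v → Shape v) → OneTriangle u p q r →
                       ¬ Reachable (G − matching shape) u r
  triangle-separated shape T@(one-triangle N _ p≁r _) u⇝r
    with Reachable-preserves (Block _ _) (λ e → uncurry (block-step T) (unmatched⁻ e)) u⇝r
           (inj₂ (inj₂ (~-sym (holds₁ N) , ~-sym (holds₂ N))))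
  ... | inj₁ refl             = distinct₁₃ N refl
  ... | inj₂ (inj₁ refl)      = distinct₂₃ N refl
  ... | inj₂ (inj₂ (p~r , _)) = ≁⇒¬~ p≁r p~r

  one-triangle-somewhere : ∀ {v} → Shape v → ∃₂ λ u p → ∃₂ λ q r → OneTriangle u p q r
  one-triangle-somewhere (one T) = _ , _ , _ , _ , T
  one-triangle-somewhere (two D) = let d , T = one-triangle-beside D in _ , _ , _ , d , T

  disconnecting-matching : (∀ v → Shape v) → Fin n → Σ (PerfectMatching G) (Disconnecting G)
  disconnecting-matching shape v with one-triangle-somewhere (shape v)
  ... | u , _ , _ , r , T =
    matching shape , u , r , step (holds₃ (OneTriangle.nbhd T)) here , triangle-separated shape T

theorem6 : ∀ {n : ℕ} (G : Graph n) → Connected G → ClawFree G → Cubic G →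
    ¬ (G ≅ K 4) → Σ (PerfectMatching G) λ M → Disconnecting G M
theorem6 {zero}  G (() , _)
theorem6 {suc n} G (_ , reach) claw-free cubic ≇K₄ =
  disconnecting-matching (shape reach claw-free ≇K₄) 0F
  where open CubicGraph G cubic
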